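{- Let $k,r,t$ be positive integers with $0<r,t<k$, $r\ne t$, and $\gcd(t,k)\neq 1$. Then the $5$-regular Cayley graph $\langle r,t,k\rangle_{2k}$ has an internal partition.
   Context: The notation $\langle i_1,\dots,i_m\rangle_n$ denotes the Cayley graph $Cay(\mathbb{Z}_n;\{\pm i_1,\dots,\pm i_m\})$: vertex set $\mathbb{Z}_n$, with $x\sim y$ iff $y-x\in\{\pm i_1,\dots,\pm i_m\}$. An internal partition of a graph is a partition of the vertex set into two nonempty sets such that every vertex has at least as many neighbours in its own class as in the other class. -}

module Defs where

open import Data.Nat using (ℕ; zero; suc; _+_; _∸_; _≡ᵇ_)
open import Data.Nat.DivMod using (_%_)
open import Data.Nat.Base using (NonZero)
open import Data.Bool using (Bool; true; false; _∨_; if_then_else_)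
open import Data.Fin using (Fin; toℕ)
open import Data.List using (List; []; _∷_; map; allFin)
open import Data.Bool.ListAction using (any)
open import Data.Nat.ListAction using (sum)
open import Data.Product using (∃; _×_)
open import Relation.Binary.PropositionalEquality using (_≡_; _≢_)

Graph : ℕ → Set
Graph n = Fin n → Fin n → Bool

-- Cayley graph Cay(ℤ_n ; {±i₁,…,±i_m}) on ℤ_n = Fin n:
-- x ~ y  iff  y - x ≡ ±g (mod n) for some generator g in the list.
-- (Fin 0 is empty, so the n = 0 clause is vacuous.)
cayley : (n : ℕ) → List ℕ → Graph n
cayley zero gens ()
cayley n@(suc _) gens x y = any matches gens
  where
  d : ℕ
  d = (toℕ y + n ∸ toℕ x) % n
  matches : ℕ → Bool
  matches g = (d ≡ᵇ (g % n)) ∨ (d ≡ᵇ ((n ∸ (g % n)) % n))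

countV : (n : ℕ) → (Fin n → Bool) → ℕ
countV n p = sum (map (λ w → if p w then 1 else 0) (allFin n))

nbrsIn : {n : ℕ} → Graph n → (Fin n → Bool) → Fin n → Bool → ℕ
nbrsIn {n} G c v b = countV n (λ w → G v w ∧' (eqB (c w) b))
  where
  _∧'_ : Bool → Bool → Bool
  true ∧' q = q
  false ∧' _ = false
  eqB : Bool → Bool → Bool
  eqB true true = true
  eqB false false = true
  eqB _ _ = false

not' : Bool → Bool
not' true = false
not' false = true

open import Data.Nat using (_≥_)

HasInternalPartition : {n : ℕ} → Graph n → Set
HasInternalPartition {n} G =
  ∃ λ (c : Fin n → Bool) →
    (∃ λ x → c x ≡ true) × (∃ λ y → c y ≡ false) ×
    ((v : Fin n) → nbrsIn G c v (c v) ≥ nbrsIn G c v (not' (c v)))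

-- Colour the vertices of ℤ_2k by divisibility by d = gcd t k; since d ≠ 1, the vertices 0 and 1
-- lie in different classes. As d divides t, k and 2k, the neighbours v + t, v − t and v + k = v − k
-- of v lie in the class of v, and they are distinct because 0 < t < k. Only the two neighbours
-- v ± r can lie in the other class, so every vertex has at least three neighbours in its own class
-- and at most two in the other.
module Submission where

open import Defs
open import Algebra.Properties.CommutativeSemigroup using (x∙yz≈y∙xz)
open import Data.Bool using (Bool; true; false; T; not; _∧_; _∨_; if_then_else_)
import Data.Bool as Bool
open import Data.Bool.Properties using (T-∧; T-∨)
open import Data.Fin using (Fin; zero; suc; toℕ; fromℕ<)
open import Data.Fin.Properties using (_≟_; toℕ<n; toℕ-fromℕ<; toℕ-injective)
open import Data.List using (List; []; _∷_; length; map; tabulate)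
open import Data.List.Membership.Propositional using (_∈_)
open import Data.List.Properties using (map-tabulate; length-map)
open import Data.List.Relation.Unary.All using (All; []; _∷_)
import Data.List.Relation.Unary.All as All
import Data.List.Relation.Unary.All.Properties as All
open import Data.List.Relation.Unary.Any using (Any; here; there)
import Data.List.Relation.Unary.Any as Any
open import Data.List.Relation.Unary.Any.Properties using (¬Any[]; any⁺; any⁻)
open import Data.List.Relation.Unary.Unique.Propositional using (Unique; []; _∷_)
open import Data.Nat using (ℕ; zero; suc; pred; _+_; _*_; _∸_; _≤_; _<_; _≥_; z≤n; s≤s; _≡ᵇ_)
open import Data.Nat.DivMod using (_%_; m%n<n; m%n%n≡m%n; %-distribˡ-+; [m+n]%n≡m%n; m<n⇒m%n≡m)
open import Data.Nat.Divisibility using (_∣_; _∣?_; _∣0; ∣1⇒≡1; ∣m+n∣m⇒∣n; ∣m∣n⇒∣m+n; ∣n∣m%n⇒∣m; %-presˡ-∣; ∣n⇒∣m*n)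
open import Data.Nat.GCD using (gcd; gcd[m,n]∣m; gcd[m,n]∣n)
open import Data.Nat.ListAction using (sum)
open import Data.Nat.Properties
  using ( ≤-refl; ≤-reflexive; ≤-trans; <-trans; ≤-<-trans; <-≤-trans; <⇒≤; <⇒≢; >⇒≢; n≤1+n
        ; +-mono-≤; +-comm; +-assoc; +-identityʳ; +-∸-assoc; m+[n∸m]≡n; m∸n+n≡m; m∸n≤m
        ; m≤n⇒m≤o+n; m<m+n; m<n⇒0<n∸m; ∸-monoʳ-<; ≡ᵇ⇒≡; ≡⇒≡ᵇ
        ; +-commutativeSemigroup; module ≤-Reasoning)
open import Data.Product using (_×_; _,_; proj₂)
open import Data.Sum using (_⊎_; inj₁; inj₂)
import Data.Sum as Sum
open import Function using (_∘_; id; _⇔_; mk⇔; Equivalence)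
open import Relation.Binary.PropositionalEquality
  using (_≡_; _≢_; ≢-sym; refl; sym; trans; cong; cong₂; subst; module ≡-Reasoning)
open import Relation.Nullary using (¬_; yes; no; does; contradiction)
open import Relation.Nullary.Decidable using (⌊_⌋; fromWitness; toWitness; does-⇔; dec-true; dec-false)

indicator : Bool → ℕ
indicator b = if b then 1 else 0

indicator≤1 : ∀ b → indicator b ≤ 1
indicator≤1 true  = ≤-refl
indicator≤1 false = z≤n

indicator-T : ∀ {b} → T b → indicator b ≡ 1
indicator-T {true} _ = refl

count : (n : ℕ) → (Fin n → Bool) → ℕ
count zero    p = 0
count (suc n) p = indicator (p zero) + count n (p ∘ suc)

sum-tabulate-indicator : ∀ n (p : Fin n → Bool) → sum (tabulate (indicator ∘ p)) ≡ count n p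
sum-tabulate-indicator zero    p = refl
sum-tabulate-indicator (suc n) p = cong (indicator (p zero) +_) (sum-tabulate-indicator n (p ∘ suc))

countV≡count : ∀ n (p : Fin n → Bool) → countV n p ≡ count n p
countV≡count n p = trans (cong sum (map-tabulate id (indicator ∘ p))) (sum-tabulate-indicator n p)

count-cong : ∀ {n} {p q : Fin n → Bool} → (∀ w → p w ≡ q w) → count n p ≡ count n q
count-cong {zero}  eq = refl
count-cong {suc n} eq = cong₂ _+_ (cong indicator (eq zero)) (count-cong (eq ∘ suc))

count-none : ∀ {n} {p : Fin n → Bool} → (∀ w → ¬ T (p w)) → count n p ≡ 0
count-none {zero}          none = refl
count-none {suc n} {p} none with p zero | none zero
... | false | _   = count-none (none ∘ suc)
... | true  | ¬pz = contradiction _ ¬pz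

_∖_ : ∀ {n} → (Fin n → Bool) → Fin n → Fin n → Bool
(p ∖ a) w = not (does (w ≟ a)) ∧ p w

T-∖ : ∀ {n} (p : Fin n → Bool) a w → T ((p ∖ a) w) ⇔ (w ≢ a × T (p w))
T-∖ p a w with w ≟ a
... | yes w≡a = mk⇔ (λ ()) (λ (w≢a , _) → contradiction w≡a w≢a)
... | no  w≢a = mk⇔ (w≢a ,_) proj₂

count-remove : ∀ {n} (p : Fin n → Bool) a → count n p ≡ indicator (p a) + count n (p ∖ a)
count-remove p zero    = refl
count-remove p (suc a) =
  trans (cong (indicator (p zero) +_) (count-remove (p ∘ suc) a))
        (x∙yz≈y∙xz +-commutativeSemigroup (indicator (p zero)) (indicator (p (suc a))) _)

count≤length : ∀ {n} (p : Fin n → Bool) (ws : List (Fin n)) →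
  (∀ w → T (p w) → w ∈ ws) → count n p ≤ length ws
count≤length p []       covered = ≤-reflexive (count-none (λ w pw → ¬Any[] (covered w pw)))
count≤length p (x ∷ ws) covered = subst (_≤ suc (length ws)) (sym (count-remove p x))
  (+-mono-≤ (indicator≤1 (p x)) (count≤length (p ∖ x) ws coveredWithout))
  where
  coveredWithout : ∀ w → T ((p ∖ x) w) → w ∈ ws
  coveredWithout w pw with T-∖ p x w .Equivalence.to pw
  ... | w≢x , pw′ with covered w pw′
  ...   | here w≡x   = contradiction w≡x w≢x
  ...   | there w∈ws = w∈ws

length≤count : ∀ {n} (p : Fin n → Bool) {ws : List (Fin n)} →
  Unique ws → All (T ∘ p) ws → length ws ≤ count n p
length≤count p []                []         = z≤n
length≤count {n} p {x ∷ ws} (x∉ws ∷ unique) (px ∷ pws) = begin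
  suc (length ws)                   ≤⟨ s≤s (length≤count (p ∖ x) unique (All.zipWith without (x∉ws , pws))) ⟩
  suc (count n (p ∖ x))             ≡⟨ cong (_+ count n (p ∖ x)) (indicator-T px) ⟨
  indicator (p x) + count n (p ∖ x) ≡⟨ count-remove p x ⟨
  count n p                         ∎
  where
  open ≤-Reasoning
  without : ∀ {w} → x ≢ w × T (p w) → T ((p ∖ x) w)
  without {w} (x≢w , pw) = T-∖ p x w .Equivalence.from (≢-sym x≢w , pw)

-- nbrsIn is built from Boolean functions local to its definition, so the predicate it counts
-- can only be named by reading it off an equation about nbrsIn.
predicate : ∀ {n m} {p : Fin n → Bool} → countV n p ≡ m → Fin n → Bool
predicate {p = p} _ = p

neighbourIn : ∀ {n} → Graph n → (Fin n → Bool) → Fin n → Bool → Fin n → Bool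
neighbourIn G c v b w = G v w ∧ ⌊ c w Bool.≟ b ⌋

nbrsIn≡count : ∀ {n} (G : Graph n) (c : Fin n → Bool) v b → nbrsIn G c v b ≡ count n (neighbourIn G c v b)
nbrsIn≡count {n} G c v b = trans (countV≡count n _) (count-cong (agree b))
  where
  agree : ∀ b w → predicate (refl {x = nbrsIn G c v b}) w ≡ neighbourIn G c v b w
  agree b w with G v w | c w
  agree _     w | false | _     = refl
  agree true  w | true  | true  = refl
  agree false w | true  | true  = refl
  agree true  w | true  | false = refl
  agree false w | true  | false = refl

∣m∣n⇒∣m∸n : ∀ {d m n} → n ≤ m → d ∣ m → d ∣ n → d ∣ m ∸ n
∣m∣n⇒∣m∸n n≤m d∣m d∣n = ∣m+n∣m⇒∣n (subst (_ ∣_) (sym (m+[n∸m]≡n n≤m)) d∣m) d∣n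

module CayleyGraph (n-1 : ℕ) where

  n : ℕ
  n = suc n-1

  diff : Fin n → Fin n → ℕ
  diff v w = (toℕ w + n ∸ toℕ v) % n

  infixl 6 _⊕_
  _⊕_ : Fin n → ℕ → Fin n
  v ⊕ a = fromℕ< (m%n<n (toℕ v + a) n)

  infix 4 _≡±_
  _≡±_ : ℕ → ℕ → Set
  x ≡± g = x ≡ g % n ⊎ x ≡ (n ∸ g % n) % n

  ≡±-refl : ∀ {g} → g < n → g ≡± g
  ≡±-refl g<n = inj₁ (sym (m<n⇒m%n≡m g<n))

  ∸≡± : ∀ {g} → g < n → n ∸ g < n → n ∸ g ≡± g
  ∸≡± g<n n∸g<n = inj₂ (sym (trans (cong (λ x → (n ∸ x) % n) (m<n⇒m%n≡m g<n)) (m<n⇒m%n≡m n∸g<n)))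

  [m%n+o]%n≡[m+o]%n : ∀ m o → (m % n + o) % n ≡ (m + o) % n
  [m%n+o]%n≡[m+o]%n m o = begin
    (m % n + o) % n           ≡⟨ %-distribˡ-+ (m % n) o n ⟩
    (m % n % n + o % n) % n   ≡⟨ cong (λ x → (x + o % n) % n) (m%n%n≡m%n m n) ⟩
    (m % n + o % n) % n       ≡⟨ %-distribˡ-+ m o n ⟨
    (m + o) % n               ∎
    where open ≡-Reasoning

  diff-⊕ : ∀ v a → diff v (v ⊕ a) ≡ a % n
  diff-⊕ v a = begin
    (toℕ (v ⊕ a) + n ∸ x) % n       ≡⟨ cong (λ y → (y + n ∸ x) % n) (toℕ-fromℕ< (m%n<n (x + a) n)) ⟩
    ((x + a) % n + n ∸ x) % n       ≡⟨ cong (_% n) (+-∸-assoc ((x + a) % n) x≤n) ⟩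
    ((x + a) % n + (n ∸ x)) % n     ≡⟨ [m%n+o]%n≡[m+o]%n (x + a) (n ∸ x) ⟩
    (x + a + (n ∸ x)) % n           ≡⟨ cong (λ y → (y + (n ∸ x)) % n) (+-comm x a) ⟩
    (a + x + (n ∸ x)) % n           ≡⟨ cong (_% n) (+-assoc a x (n ∸ x)) ⟩
    (a + (x + (n ∸ x))) % n         ≡⟨ cong (λ y → (a + y) % n) (m+[n∸m]≡n x≤n) ⟩
    (a + n) % n                     ≡⟨ [m+n]%n≡m%n a n ⟩
    a % n                           ∎
    where
    open ≡-Reasoning
    x : ℕ
    x = toℕ v
    x≤n : x ≤ n
    x≤n = <⇒≤ (toℕ<n v)

  ⊕-diff : ∀ v w → v ⊕ diff v w ≡ w
  ⊕-diff v w = toℕ-injective (begin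
    toℕ (v ⊕ diff v w)         ≡⟨ toℕ-fromℕ< (m%n<n (x + diff v w) n) ⟩
    (x + (y + n ∸ x) % n) % n  ≡⟨ cong (_% n) (+-comm x _) ⟩
    ((y + n ∸ x) % n + x) % n  ≡⟨ [m%n+o]%n≡[m+o]%n (y + n ∸ x) x ⟩
    (y + n ∸ x + x) % n        ≡⟨ cong (_% n) (m∸n+n≡m (m≤n⇒m≤o+n y (<⇒≤ (toℕ<n v)))) ⟩
    (y + n) % n                ≡⟨ [m+n]%n≡m%n y n ⟩
    y % n                      ≡⟨ m<n⇒m%n≡m (toℕ<n w) ⟩
    y                          ∎)
    where
    open ≡-Reasoning
    x y : ℕ
    x = toℕ v
    y = toℕ w

  ⊕-injective : ∀ {v a b} → a < n → b < n → v ⊕ a ≡ v ⊕ b → a ≡ b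
  ⊕-injective {v} {a} {b} a<n b<n eq = begin
    a                ≡⟨ m<n⇒m%n≡m a<n ⟨
    a % n            ≡⟨ diff-⊕ v a ⟨
    diff v (v ⊕ a)   ≡⟨ cong (diff v) eq ⟩
    diff v (v ⊕ b)   ≡⟨ diff-⊕ v b ⟩
    b % n            ≡⟨ m<n⇒m%n≡m b<n ⟩
    b                ∎
    where open ≡-Reasoning

  ⊕-unique : ∀ v {as : List ℕ} → Unique as → All (_< n) as → Unique (map (v ⊕_) as)
  ⊕-unique v []              []           = []
  ⊕-unique v (a∉as ∷ unique) (a<n ∷ as<n) =
    All.map⁺ (All.zipWith (λ (b<n , a≢b) → a≢b ∘ ⊕-injective {v} a<n b<n) (as<n , a∉as))
    ∷ ⊕-unique v unique as<n

  T-≡± : ∀ x g → T ((x ≡ᵇ g % n) ∨ (x ≡ᵇ (n ∸ g % n) % n)) ⇔ x ≡± g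
  T-≡± x g = mk⇔ (Sum.map (≡ᵇ⇒≡ _ _) (≡ᵇ⇒≡ _ _) ∘ T-∨ .Equivalence.to)
                 (T-∨ .Equivalence.from ∘ Sum.map (≡⇒≡ᵇ _ _) (≡⇒≡ᵇ _ _))

  T-cayley : ∀ gens v w → T (cayley n gens v w) ⇔ Any (diff v w ≡±_) gens
  T-cayley gens v w =
    mk⇔ (λ adj → Any.map (λ {g} → T-≡± (diff v w) g .Equivalence.to) (any⁻ _ gens adj))
        (λ any → any⁺ _ (Any.map (λ {g} → T-≡± (diff v w) g .Equivalence.from) any))

  ≡±-pres-∣ : ∀ {d x g} → d ∣ n → d ∣ g → x ≡± g → d ∣ x
  ≡±-pres-∣ d∣n d∣g (inj₁ refl) = %-presˡ-∣ d∣g d∣n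
  ≡±-pres-∣ {g = g} d∣n d∣g (inj₂ refl) =
    %-presˡ-∣ (∣m∣n⇒∣m∸n (<⇒≤ (m%n<n g n)) d∣n (%-presˡ-∣ d∣g d∣n)) d∣n

  ∣-diff : ∀ {d} v w → d ∣ n → d ∣ diff v w → d ∣ toℕ w ⇔ d ∣ toℕ v
  ∣-diff {d} v w d∣n d∣diff = mk⇔
    (λ d∣y → ∣m+n∣m⇒∣n (subst (d ∣_) (sym s+x≡y+n) (∣m∣n⇒∣m+n d∣y d∣n)) d∣s)
    (λ d∣x → ∣m+n∣m⇒∣n (subst (d ∣_) (+-comm y n) (subst (d ∣_) s+x≡y+n (∣m∣n⇒∣m+n d∣s d∣x))) d∣n)
    where
    x y s : ℕ
    x = toℕ v
    y = toℕ w
    s = y + n ∸ x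
    d∣s : d ∣ s
    d∣s = ∣n∣m%n⇒∣m d∣n d∣diff
    s+x≡y+n : s + x ≡ y + n
    s+x≡y+n = m∸n+n≡m (m≤n⇒m≤o+n y (<⇒≤ (toℕ<n v)))

  divisibleBy : ℕ → Fin n → Bool
  divisibleBy d w = does (d ∣? toℕ w)

  divisibleBy-diff : ∀ {d} v w → d ∣ n → d ∣ diff v w → divisibleBy d w ≡ divisibleBy d v
  divisibleBy-diff {d} v w d∣n d∣diff = does-⇔ (∣-diff v w d∣n d∣diff) (d ∣? toℕ w) (d ∣? toℕ v)

  nbrsIn-otherClass≤2 : ∀ {d} r gens v {b} → d ∣ n → All (d ∣_) gens → b ≢ divisibleBy d v →
    nbrsIn (cayley n (r ∷ gens)) (divisibleBy d) v b ≤ 2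
  nbrsIn-otherClass≤2 {d} r gens v {b} d∣n d∣gens b≢cv = begin
    nbrsIn G c v b                ≡⟨ nbrsIn≡count G c v b ⟩
    count n (neighbourIn G c v b) ≤⟨ count≤length (neighbourIn G c v b) _ covered ⟩
    2                             ∎
    where
    open ≤-Reasoning
    G : Graph n
    G = cayley n (r ∷ gens)
    c : Fin n → Bool
    c = divisibleBy d
    covered : ∀ w → T (neighbourIn G c v b w) →
              w ∈ v ⊕ r % n ∷ v ⊕ (n ∸ r % n) % n ∷ []
    covered w adj∧outside with T-∧ .Equivalence.to adj∧outside
    ... | adj , outside with T-cayley (r ∷ gens) v w .Equivalence.to adj
    ...   | here (inj₁ diff≡r)  = here (trans (sym (⊕-diff v w)) (cong (v ⊕_) diff≡r))
    ...   | here (inj₂ diff≡-r) = there (here (trans (sym (⊕-diff v w)) (cong (v ⊕_) diff≡-r)))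
    ...   | there ±gens        = contradiction
      (trans (sym (toWitness {a? = divisibleBy d w Bool.≟ b} outside)) (divisibleBy-diff v w d∣n d∣diff)) b≢cv
      where
      d∣diff : d ∣ diff v w
      d∣diff = All.lookupWith (≡±-pres-∣ d∣n) d∣gens ±gens

  length≤nbrsIn-ownClass : ∀ {d} gens v {as : List ℕ} → d ∣ n → Unique as → All (_< n) as →
    All (λ a → d ∣ a × Any (a ≡±_) gens) as →
    length as ≤ nbrsIn (cayley n gens) (divisibleBy d) v (divisibleBy d v)
  length≤nbrsIn-ownClass {d} gens v {as} d∣n unique as<n generated = begin
    length as                         ≡⟨ length-map (v ⊕_) as ⟨
    length (map (v ⊕_) as)            ≤⟨ length≤count (neighbourIn G c v (c v)) (⊕-unique v unique as<n)
                                                      (All.map⁺ (All.zipWith inside (as<n , generated))) ⟩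
    count n (neighbourIn G c v (c v)) ≡⟨ nbrsIn≡count G c v (c v) ⟨
    nbrsIn G c v (c v)                ∎
    where
    open ≤-Reasoning
    G : Graph n
    G = cayley n gens
    c : Fin n → Bool
    c = divisibleBy d
    inside : ∀ {a} → a < n × d ∣ a × Any (a ≡±_) gens →
             T (neighbourIn G c v (c v) (v ⊕ a))
    inside {a} (a<n , d∣a , ±gens) = T-∧ .Equivalence.from
      ( T-cayley gens v (v ⊕ a) .Equivalence.from (subst (λ x → Any (x ≡±_) gens) (sym diff≡a) ±gens)
      , fromWitness {a? = divisibleBy d (v ⊕ a) Bool.≟ divisibleBy d v}
                    (divisibleBy-diff v (v ⊕ a) d∣n (subst (d ∣_) (sym diff≡a) d∣a)) )
      where
      diff≡a : diff v (v ⊕ a) ≡ a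
      diff≡a = trans (diff-⊕ v a) (m<n⇒m%n≡m a<n)

k<2k∸t : ∀ {k t} → t < k → k < 2 * k ∸ t
k<2k∸t {k} {t} t<k = begin-strict
  k               <⟨ m<m+n k (m<n⇒0<n∸m t<k) ⟩
  k + (k ∸ t)     ≡⟨ +-∸-assoc k (<⇒≤ t<k) ⟨
  (k + k) ∸ t     ≡⟨ cong (λ x → (k + x) ∸ t) (+-identityʳ k) ⟨
  2 * k ∸ t       ∎
  where open ≤-Reasoning

module HalfTurnCayleyGraph (k-1 : ℕ) {t : ℕ} (0<t : 0 < t) (t<k : t < suc k-1) where

  k : ℕ
  k = suc k-1

  open CayleyGraph (pred (2 * k)) public

  k<n∸t : k < n ∸ t
  k<n∸t = k<2k∸t t<k

  k<n : k < n
  k<n = <-≤-trans k<n∸t (m∸n≤m n t)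

  t<n : t < n
  t<n = <-trans t<k k<n

  n∸t<n : n ∸ t < n
  n∸t<n = ∸-monoʳ-< 0<t (<⇒≤ t<n)

  1<n : 1 < n
  1<n = ≤-<-trans 0<t t<n

  3≤nbrsIn-ownClass : ∀ {d} r v → d ∣ t → d ∣ k →
    3 ≤ nbrsIn (cayley n (r ∷ t ∷ k ∷ [])) (divisibleBy d) v (divisibleBy d v)
  3≤nbrsIn-ownClass {d} r v d∣t d∣k = length≤nbrsIn-ownClass (r ∷ t ∷ k ∷ []) v d∣n
    ((<⇒≢ (<-trans t<k k<n∸t) ∷ <⇒≢ t<k ∷ []) ∷ (>⇒≢ k<n∸t ∷ []) ∷ [] ∷ [])
    (t<n ∷ n∸t<n ∷ k<n ∷ [])
    ( (d∣t , there (here (≡±-refl t<n)))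
    ∷ (∣m∣n⇒∣m∸n (<⇒≤ t<n) d∣n d∣t , there (here (∸≡± t<n n∸t<n)))
    ∷ (d∣k , there (there (here (≡±-refl k<n))))
    ∷ [])
    where
    d∣n : d ∣ n
    d∣n = ∣n⇒∣m*n 2 d∣k

not'≢ : ∀ b → not' b ≢ b
not'≢ true  ()
not'≢ false ()

-- The hypotheses on r are only needed for the graph to be 5-regular: the partition into
-- multiples and non-multiples of gcd t k is internal for every r.
mainTheorem11 : (k r t : ℕ) → 0 < k → 0 < r → r < k → 0 < t → t < k → r ≢ t → gcd t k ≢ 1 →
    HasInternalPartition (cayley (2 * k) (r ∷ t ∷ k ∷ []))
mainTheorem11 (suc k-1) r t _ _ _ 0<t t<k _ gcd≢1 =
  c , (zero , dec-true (d ∣? 0) (d ∣0)) , (one , dec-false (d ∣? toℕ one) d∤1) , internal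
  where
  open HalfTurnCayleyGraph k-1 0<t t<k
  d : ℕ
  d = gcd t k
  c : Fin n → Bool
  c = divisibleBy d
  d∣t : d ∣ t
  d∣t = gcd[m,n]∣m t k
  d∣k : d ∣ k
  d∣k = gcd[m,n]∣n t k
  one : Fin n
  one = fromℕ< 1<n
  d∤1 : ¬ d ∣ toℕ one
  d∤1 d∣1 = gcd≢1 (∣1⇒≡1 (subst (d ∣_) (toℕ-fromℕ< 1<n) d∣1))
  internal : ∀ v → nbrsIn (cayley n (r ∷ t ∷ k ∷ [])) c v (c v)
                 ≥ nbrsIn (cayley n (r ∷ t ∷ k ∷ [])) c v (not' (c v))
  internal v = ≤-trans
    (nbrsIn-otherClass≤2 r (t ∷ k ∷ []) v (∣n⇒∣m*n 2 d∣k) (d∣t ∷ d∣k ∷ []) (not'≢ (c v)))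
    (≤-trans (n≤1+n 2) (3≤nbrsIn-ownClass r v d∣t d∣k))
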